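{- Let $D_0$ be a two-row diagram whose nonempty rows are $r_1<r_2$. Then $$|Min(D_0)|=\begin{cases}|\mathrm{Col}^{\leftarrow}(D_0;r_1)|+1,& r_1>1,\\ 1,& r_1=1.\end{cases}$$
   Context: A diagram is a finite set $D$ of cells $(r,c)$ with $r,c$ positive integers; $r$ is the row (rows numbered from bottom to top starting at 1) and $c$ the column (numbered from left to right starting at 1). A Kohnert move at row $r$ applied to a diagram $D$: if row $r$ of $D$ is empty, $D$ is unchanged; otherwise let $(r,c)$ be the cell of row $r$ with the largest column index; if every position $(r',c)$ with $1\le r'<r$ belongs to $D$, then $D$ is unchanged; otherwise let $r'$ be the largest integer with $1\le r'<r$ and $(r',c)\notin D$, and the move replaces the cell $(r,c)$ by $(r',c)$. For a diagram $D_0$, $KD(D_0)$ is the set of all diagrams obtainable from $D_0$ by finite (possibly empty) sequences of Kohnert moves; the Kohnert poset $\mathcal{P}(D_0)$ is $KD(D_0)$ ordered by $D_2\preceq D_1$ iff $D_2$ can be obtained from $D_1$ by a finite sequence of Kohnert moves; $Min(D_0)$ is its set of minimal elements. A two-row diagram is a diagram with exactly two nonempty rows (not necessarily consecutive). For such $D_0$ with nonempty rows $r_1<r_2$: $\mathrm{Col}(D_0;r_1,r_2)$ is the set of columns containing cells in both rows; for $i=1,2$, $\mathrm{Col}(D_0;r_i)$ is the set of columns containing a cell only in row $r_i$; $\mathrm{Col}^{\leftarrow}(D_0;r_i)=\{c\in\mathrm{Col}(D_0;r_i): c<\max\mathrm{Col}(D_0;r_1,r_2)\}$ and $\mathrm{Col}^{\rightarrow}(D_0;r_i)=\{c\in\mathrm{Col}(D_0;r_i):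 c>\max\mathrm{Col}(D_0;r_1,r_2)\}$, both taken to be empty when $\mathrm{Col}(D_0;r_1,r_2)=\emptyset$. -}

module Defs where

open import Data.Nat using (ℕ; _<_; _≤_; suc)
open import Data.Product using (Σ; _×_; _,_; ∃; ∃-syntax)
open import Data.Sum using (_⊎_)
open import Data.List using (List; length)
open import Data.List.Membership.Propositional using (_∈_; _∉_)
open import Data.List.Relation.Unary.All using (All)
open import Data.List.Relation.Unary.Any using (Any)
open import Data.List.Relation.Unary.Unique.Propositional using (Unique)
open import Data.List.Relation.Unary.AllPairs using (AllPairs)
open import Relation.Binary.PropositionalEquality using (_≡_; _≢_)
open import Relation.Binary.Construct.Closure.ReflexiveTransitive using (Star)
open import Relation.Nullary using (¬_)
open import Function.Bundles using (_⇔_)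

-- A cell (r , c) : row r, column c (both ≥ 1).
Cell : Set
Cell = ℕ × ℕ

-- A diagram is a finite set of cells, represented by a list read as a set
-- (order and repetitions irrelevant); diagrams are compared by ≈ below.
Diagram : Set
Diagram = List Cell

Valid : Diagram → Set
Valid D = ∀ r c → (r , c) ∈ D → (1 ≤ r × 1 ≤ c)

_≈_ : Diagram → Diagram → Set
D ≈ E = ∀ x → (x ∈ D ⇔ x ∈ E)

-- A (non-trivial) Kohnert move at row r: (r , c) is the rightmost cell of row r,
-- r' is the largest row index 1 ≤ r' < r with (r' , c) ∉ D, and E is D with
-- (r , c) replaced by (r' , c).  (Moves leaving D unchanged are omitted: they
-- do not affect reachability.)
KohnertStep : Diagram → Diagram → Set
KohnertStep D E =
  ∃[ r ] ∃[ c ] ∃[ r' ]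
    ( (r , c) ∈ D
    × (∀ c' → (r , c') ∈ D → c' ≤ c)
    × 1 ≤ r' × r' < r
    × (r' , c) ∉ D
    × (∀ r'' → r' < r'' → r'' < r → (r'' , c) ∈ D)
    × (∀ x → (x ∈ E ⇔ ((x ∈ D × x ≢ (r , c)) ⊎ x ≡ (r' , c)))) )

Reach : Diagram → Diagram → Set
Reach D E = ∃[ F ] (Star KohnertStep D F × F ≈ E)

InKD : Diagram → Diagram → Set
InKD D0 D = Reach D0 D

IsMin : Diagram → Diagram → Set
IsMin D0 D = InKD D0 D × (∀ E → Reach D E → E ≈ D)

MinCard : Diagram → ℕ → Set
MinCard D0 n =
  Σ (List Diagram) λ Ms →
      length Ms ≡ n
    × AllPairs (λ D E → ¬ (D ≈ E)) Ms
    × All (IsMin D0) Ms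
    × (∀ D → IsMin D0 D → Any (λ M → M ≈ D) Ms)

HasCard : (ℕ → Set) → ℕ → Set
HasCard P n =
  Σ (List ℕ) λ l → length l ≡ n × Unique l × (∀ c → (c ∈ l ⇔ P c))

RowNonempty : Diagram → ℕ → Set
RowNonempty D r = ∃[ c ] ((r , c) ∈ D)

TwoRow : Diagram → ℕ → ℕ → Set
TwoRow D r1 r2 =
    Valid D
  × r1 < r2
  × RowNonempty D r1
  × RowNonempty D r2
  × (∀ r c → (r , c) ∈ D → (r ≡ r1 ⊎ r ≡ r2))

-- c ∈ Col←(D;r1): c has a cell only in row r1 and c < max Col(D;r1,r2)
-- (equivalently, some column c' > c has cells in both rows; empty when
-- Col(D;r1,r2) = ∅).
ColLeft : Diagram → ℕ → ℕ → ℕ → Set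
ColLeft D r1 r2 c =
    (r1 , c) ∈ D
  × (r2 , c) ∉ D
  × ∃[ c' ] ((r1 , c') ∈ D × (r2 , c') ∈ D × c < c')

{-# OPTIONS --safe #-}
-- A diagram reachable from D0 keeps every cell in its column, so it is D0 placed by a height
-- function h. Along Kohnert moves h stays injective on each column and bounded by the original
-- rows, and since a lone cell moves only when it is rightmost in its row, it never drops below a
-- cell to its right that started no higher. A minimal diagram is one where no move applies; with
-- this invariant it uses only rows 1 and 2, stacks each two-cell column into rows 1 and 2, and
-- puts a lone cell in row 2 exactly when a two-cell column lies to its right. The only freedom
-- is among the lower cells of Col←(D0; r1): those in row 2 form an initial segment {c ≤ t}.
-- Hence the minimal diagrams are the M_t for t ∈ {0} ∪ Col←(D0; r1); conversely every such M_t
-- is reached column by column from the right, which needs r1 ≥ 2 as soon as t > 0.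

module Submission where

open import Defs
open import Data.Bool using (if_then_else_)
open import Data.Empty using (⊥; ⊥-elim)
open import Data.List using (List; []; _∷_; map; length; filter; upTo)
open import Data.List.Properties using (map-id; map-cong-local; length-map)
open import Data.List.Membership.Propositional using (_∈_; _∉_)
open import Data.List.Membership.Propositional.Properties
  using (∈-map⁺; ∈-map⁻; ∈-filter⁺; ∈-filter⁻; ∈-upTo⁺)
open import Data.List.Relation.Unary.All as All using (All; []; _∷_)
import Data.List.Relation.Unary.All.Properties as Allₚ
open import Data.List.Relation.Unary.Any as Any using (Any; here; there; any?; satisfied)
import Data.List.Relation.Unary.Any.Properties as Anyₚ
open import Data.List.Relation.Unary.AllPairs as AllPairs using (AllPairs; []; _∷_)
import Data.List.Relation.Unary.AllPairs.Properties as AllPairsₚ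
open import Data.Nat
open import Data.Nat.Properties
open import Data.Product using (∃-syntax; _×_; _,_; proj₁; proj₂)
open import Data.Product.Properties using (≡-dec)
import Data.Product as Product
import Data.Sum as Sum
open import Data.Sum using (_⊎_; inj₁; inj₂; [_,_]′)
open import Function using (id; _∘_)
open import Function.Bundles using (_⇔_; mk⇔; Equivalence)
import Function.Properties.Equivalence as ⇔
open import Relation.Binary.Construct.Closure.ReflexiveTransitive using (Star; ε; _◅_; _◅◅_)
open import Relation.Binary.Definitions using (DecidableEquality)
open import Relation.Binary.PropositionalEquality
open import Relation.Nullary using (¬_; Dec; yes; no; does)
open import Relation.Nullary.Decidable using (_×-dec_; ¬?; map′; dec-true; dec-false; does-⇔; toSum)
open import Relation.Unary using (Decidable)

open Equivalence

_≟ᶜ_ : DecidableEquality Cell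
_≟ᶜ_ = ≡-dec _≟_ _≟_

open import Data.List.Membership.DecPropositional _≟ᶜ_ using (_∈?_)

if-yes : ∀ {A B : Set} (a? : Dec A) {x y : B} → A → (if does a? then x else y) ≡ x
if-yes a? a rewrite dec-true a? a = refl

if-no : ∀ {A B : Set} (a? : Dec A) {x y : B} → ¬ A → (if does a? then x else y) ≡ y
if-no a? ¬a rewrite dec-false a? ¬a = refl

1≢2 : 1 ≢ 2
1≢2 ()

1≤n≤2⇒n≡1⊎n≡2 : ∀ {n} → 1 ≤ n → n ≤ 2 → n ≡ 1 ⊎ n ≡ 2
1≤n≤2⇒n≡1⊎n≡2 {1} _ _ = inj₁ refl
1≤n≤2⇒n≡1⊎n≡2 {2} _ _ = inj₂ refl
1≤n≤2⇒n≡1⊎n≡2 {suc (suc (suc _))} _ (s≤s (s≤s ()))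

strict-upper-bound : ∀ {A : Set} (f : A → ℕ) (xs : List A) → ∃[ N ] (∀ x → x ∈ xs → f x < N)
strict-upper-bound f [] = 0 , λ _ ()
strict-upper-bound f (y ∷ xs) with strict-upper-bound f xs
... | N , bound = suc (f y) ⊔ N , λ where
  x (here refl) → m≤m⊔n (suc (f y)) N
  x (there x∈) → ≤-trans (bound x x∈) (m≤n⊔m (suc (f y)) N)

maximum-satisfying : ∀ {A : Set} (f : A → ℕ) {P : A → Set} → Decidable P → (xs : List A) →
  (∃[ x ] (x ∈ xs × P x × (∀ y → y ∈ xs → P y → f y ≤ f x))) ⊎ (∀ y → y ∈ xs → ¬ P y)
maximum-satisfying f P? [] = inj₂ (λ _ ())
maximum-satisfying f P? (z ∷ xs) with maximum-satisfying f P? xs | P? z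
... | inj₂ none | no ¬pz = inj₂ λ where
  y (here refl) → ¬pz
  y (there y∈) → none y y∈
... | inj₂ none | yes pz = inj₁ (z , here refl , pz , λ where
  y (here refl) _ → ≤-refl
  y (there y∈) py → ⊥-elim (none y y∈ py))
... | inj₁ (x , x∈ , px , max) | no ¬pz = inj₁ (x , there x∈ , px , λ where
  y (here refl) py → ⊥-elim (¬pz py)
  y (there y∈) py → max y y∈ py)
... | inj₁ (x , x∈ , px , max) | yes pz with f x <? f z
...   | yes fx<fz = inj₁ (z , here refl , pz , λ where
  y (here refl) _ → ≤-refl
  y (there y∈) py → <⇒≤ (≤-<-trans (max y y∈ py) fx<fz))
...   | no fx≮fz = inj₁ (x , there x∈ , px , λ where
  y (here refl) _ → ≮⇒≥ fx≮fz
  y (there y∈) py → max y y∈ py)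

highest-gap : ∀ (D : Diagram) c r0 n → r0 < n → (r0 , c) ∉ D →
  ∃[ r' ] (r0 ≤ r' × r' < n × (r' , c) ∉ D × (∀ r'' → r' < r'' → r'' < n → (r'' , c) ∈ D))
highest-gap D c r0 (suc m) (s≤s r0≤m) r0∉ with (m , c) ∈? D
... | no m∉ = m , r0≤m , ≤-refl , m∉ , λ r'' m<r'' r''<1+m → ⊥-elim (<⇒≱ m<r'' (≤-pred r''<1+m))
... | yes m∈ with m≤n⇒m<n∨m≡n r0≤m
...   | inj₂ refl = ⊥-elim (r0∉ m∈)
...   | inj₁ r0<m with highest-gap D c r0 m r0<m r0∉
...     | r' , r0≤r' , r'<m , r'∉ , filled =
  r' , r0≤r' , m<n⇒m<1+n r'<m , r'∉ ,
  λ r'' r'<r'' r''<1+m → [ filled r'' r'<r'' , (λ { refl → m∈ }) ]′ (m≤n⇒m<n∨m≡n (≤-pred r''<1+m))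

allPairs-zipʳ : ∀ {A : Set} {R : A → A → Set} {P : A → Set} {xs} →
                AllPairs R xs → All P xs → AllPairs (λ a b → R a b × P b) xs
allPairs-zipʳ [] [] = []
allPairs-zipʳ (Rx ∷ Rxs) (_ ∷ Pxs) = All.zip (Rx , Pxs) ∷ allPairs-zipʳ Rxs Pxs

≈-refl : ∀ {D} → D ≈ D
≈-refl _ = ⇔.refl

≈-sym : ∀ {D E} → D ≈ E → E ≈ D
≈-sym D≈E x = ⇔.sym (D≈E x)

≈-trans : ∀ {D E F} → D ≈ E → E ≈ F → D ≈ F
≈-trans D≈E E≈F x = ⇔.trans (D≈E x) (E≈F x)

KohnertStep-respˡ-≈ : ∀ {D D' E} → D ≈ D' → KohnertStep D E → KohnertStep D' E
KohnertStep-respˡ-≈ D≈D' (r , c , r' , rc∈ , rightmost , 1≤r' , r'<r , r'c∉ , between , E⇔) =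
  r , c , r' , to (D≈D' _) rc∈ , (λ c' m → rightmost c' (from (D≈D' _) m)) , 1≤r' , r'<r ,
  (λ m → r'c∉ (from (D≈D' _) m)) , (λ r'' p q → to (D≈D' _) (between r'' p q)) ,
  λ x → ⇔.trans (E⇔ x) (mk⇔ (Sum.map₁ (Product.map₁ (to (D≈D' x))))
                            (Sum.map₁ (Product.map₁ (from (D≈D' x)))))

Heights : Set
Heights = Cell → ℕ

_[_≔_] : Heights → Cell → ℕ → Heights
(h [ x ≔ v ]) z with z ≟ᶜ x
... | yes _ = v
... | no _ = h z

update-view : ∀ h x v z → (z ≡ x × (h [ x ≔ v ]) z ≡ v) ⊎ (z ≢ x × (h [ x ≔ v ]) z ≡ h z)
update-view h x v z with z ≟ᶜ x
... | yes z≡x = inj₁ (z≡x , refl)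
... | no z≢x = inj₂ (z≢x , refl)

update-updates : ∀ h x v → (h [ x ≔ v ]) x ≡ v
update-updates h x v with update-view h x v x
... | inj₁ (_ , e) = e
... | inj₂ (x≢x , _) = ⊥-elim (x≢x refl)

update-minimal : ∀ h x v z → z ≢ x → (h [ x ≔ v ]) z ≡ h z
update-minimal h x v z z≢x with update-view h x v z
... | inj₁ (z≡x , _) = ⊥-elim (z≢x z≡x)
... | inj₂ (_ , e) = e

update-update : ∀ h x v w z → ((h [ x ≔ v ]) [ x ≔ w ]) z ≡ (h [ x ≔ w ]) z
update-update h x v w z with update-view (h [ x ≔ v ]) x w z
... | inj₁ (refl , e) = trans e (sym (update-updates h x w))
... | inj₂ (z≢x , e) = trans e (trans (update-minimal h x v z z≢x) (sym (update-minimal h x w z z≢x)))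

update-id : ∀ h x v → h x ≡ v → ∀ z → (h [ x ≔ v ]) z ≡ h z
update-id h x v hx≡v z with update-view h x v z
... | inj₁ (refl , e) = trans e (sym hx≡v)
... | inj₂ (_ , e) = e

-- Every diagram of KD(D0) is D0 with each cell y moved to row h y of its own column.
module Placement (D0 : Diagram) where

  place : Heights → Diagram
  place h = map (λ y → h y , proj₂ y) D0

  ∈-place⁺ : ∀ {h x} y → y ∈ D0 → x ≡ (h y , proj₂ y) → x ∈ place h
  ∈-place⁺ {h} y y∈ refl = ∈-map⁺ (λ y → h y , proj₂ y) y∈

  ∈-place⁻ : ∀ {h x} → x ∈ place h → ∃[ y ] (y ∈ D0 × x ≡ (h y , proj₂ y))
  ∈-place⁻ {h} = ∈-map⁻ (λ y → h y , proj₂ y)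

  place-cong : ∀ {h h'} → (∀ y → y ∈ D0 → h y ≡ h' y) → place h ≡ place h'
  place-cong h≡h' = map-cong-local (All.tabulate λ {y} y∈ → cong (_, proj₂ y) (h≡h' y y∈))

  place-rows : place proj₁ ≡ D0
  place-rows = map-id D0

  Steps : Diagram → Diagram → Set
  Steps = Star KohnertStep

  Unshared : Heights → Cell → Set
  Unshared h x = ∀ y → y ∈ D0 → proj₂ y ≡ proj₂ x → h y ≡ h x → y ≡ x

  place-update : ∀ h x v → Unshared h x → x ∈ D0 → ∀ z →
    z ∈ place (h [ x ≔ v ]) ⇔ ((z ∈ place h × z ≢ (h x , proj₂ x)) ⊎ z ≡ (v , proj₂ x))
  place-update h x v unshared x∈ z = mk⇔ forth back
    where
    forth : z ∈ place (h [ x ≔ v ]) → (z ∈ place h × z ≢ (h x , proj₂ x)) ⊎ z ≡ (v , proj₂ x)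
    forth z∈ with ∈-place⁻ z∈
    ... | y , y∈ , refl with update-view h x v y
    ...   | inj₁ (refl , e) = inj₂ (cong (_, proj₂ x) e)
    ...   | inj₂ (y≢x , e) rewrite e =
      inj₁ (∈-place⁺ y y∈ refl , λ eq → y≢x (unshared y y∈ (cong proj₂ eq) (cong proj₁ eq)))
    back : (z ∈ place h × z ≢ (h x , proj₂ x)) ⊎ z ≡ (v , proj₂ x) → z ∈ place (h [ x ≔ v ])
    back (inj₁ (z∈ , z≢)) with ∈-place⁻ z∈
    ... | y , y∈ , refl with update-view h x v y
    ...   | inj₁ (refl , _) = ⊥-elim (z≢ refl)
    ...   | inj₂ (_ , e) = ∈-place⁺ y y∈ (cong (_, proj₂ y) (sym e))
    back (inj₂ refl) = ∈-place⁺ x x∈ (cong (_, proj₂ x) (sym (update-updates h x v)))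

  record Descent (h : Heights) (x : Cell) (r' : ℕ) : Set where
    constructor descent
    field
      rightmost : ∀ y → y ∈ D0 → h y ≡ h x → proj₂ y ≤ proj₂ x
      1≤r'      : 1 ≤ r'
      r'<hx     : r' < h x
      vacant    : ∀ y → y ∈ D0 → proj₂ y ≡ proj₂ x → h y ≢ r'
      occupied  : ∀ r'' → r' < r'' → r'' < h x → (r'' , proj₂ x) ∈ place h

  kohnertStep-update : ∀ h x r' → x ∈ D0 → Descent h x r' → Unshared h x →
    KohnertStep (place h) (place (h [ x ≔ r' ]))
  kohnertStep-update h x r' x∈ (descent rightmost 1≤r' r'<hx vacant occupied) unshared =
    h x , proj₂ x , r' , ∈-place⁺ x x∈ refl ,
    (λ c m → let (y , y∈ , eq) = ∈-place⁻ m in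
             subst (_≤ proj₂ x) (sym (cong proj₂ eq)) (rightmost y y∈ (sym (cong proj₁ eq)))) ,
    1≤r' , r'<hx ,
    (λ m → let (y , y∈ , eq) = ∈-place⁻ m in vacant y y∈ (sym (cong proj₂ eq)) (sym (cong proj₁ eq))) ,
    occupied , place-update h x r' unshared x∈

  kohnertStep⇒descent : ∀ {F G} h → (∀ x → x ∈ D0 → Unshared h x) → F ≈ place h → KohnertStep F G →
    ∃[ x ] ∃[ r' ] (x ∈ D0 × Descent h x r' × G ≈ place (h [ x ≔ r' ]))
  kohnertStep⇒descent {F} {G} h unshared F≈
    (r , c , r' , rc∈ , rightmost , 1≤r' , r'<r , r'c∉ , between , G⇔) with ∈-place⁻ {h} (to (F≈ _) rc∈)
  ... | x , x∈ , refl =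
    x , r' , x∈ ,
    descent (λ y y∈ e → rightmost (proj₂ y) (from (F≈ _) (∈-place⁺ y y∈ (cong (_, proj₂ y) (sym e)))))
            1≤r' r'<r
            (λ y y∈ same e → r'c∉ (from (F≈ _) (∈-place⁺ y y∈ (cong₂ _,_ (sym e) (sym same)))))
            (λ r'' p q → to (F≈ _) (between r'' p q)) ,
    λ z → ⇔.trans (G⇔ z) (⇔.trans (mk⇔ (Sum.map₁ (Product.map₁ (to (F≈ z))))
                                        (Sum.map₁ (Product.map₁ (from (F≈ z)))))
                                   (⇔.sym (place-update h x r' (unshared x x∈) x∈ z)))

  slide-down-by : ∀ h x → x ∈ D0 → ∀ b k → 1 ≤ b →
    (∀ j → b < j → j ≤ b + k → ∀ y → y ∈ D0 → y ≢ x → h y ≡ j → proj₂ y ≤ proj₂ x) →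
    (∀ y → y ∈ D0 → y ≢ x → proj₂ y ≡ proj₂ x → h y < b ⊎ b + k < h y) →
    Steps (place (h [ x ≔ b + k ])) (place (h [ x ≔ b ]))
  slide-down-by h x x∈ b zero _ _ _ rewrite +-identityʳ b = ε
  slide-down-by h x x∈ b (suc k) 1≤b rightmost outside =
    subst (Steps (place h₁)) (place-cong (λ z _ → update-update h x (b + suc k) (b + k) z)) (step ◅ ε)
    ◅◅ slide-down-by h x x∈ b k 1≤b (λ j p q → rightmost j p (≤-trans q (+-monoʳ-≤ b (n≤1+n k))))
         (λ y y∈ y≢x same → [ inj₁ , (λ lt → inj₂ (<-trans b+k<top lt)) ]′ (outside y y∈ y≢x same))
    where
    h₁ = h [ x ≔ b + suc k ]
    h₁x : h₁ x ≡ b + suc k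
    h₁x = update-updates h x (b + suc k)
    b+k<top : b + k < b + suc k
    b+k<top = +-monoʳ-< b (n<1+n k)
    avoids : ∀ {v} → v < b ⊎ b + suc k < v → v ≢ b + k × v ≢ b + suc k
    avoids (inj₁ v<b) = (λ { refl → <⇒≱ v<b (m≤m+n b k) }) , (λ { refl → <⇒≱ v<b (m≤m+n b (suc k)) })
    avoids (inj₂ top<v) = (λ { refl → <-asym b+k<top top<v }) , (λ { refl → <-irrefl refl top<v })
    step : KohnertStep (place h₁) (place (h₁ [ x ≔ b + k ]))
    step = kohnertStep-update h₁ x (b + k) x∈ (descent
      (λ y y∈ e → [ (λ { (refl , _) → ≤-refl }) ,
                    (λ { (y≢x , e') → rightmost (b + suc k) (m<m+n b z<s) ≤-refl y y∈ y≢x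
                                        (trans (sym e') (trans e h₁x)) }) ]′
                  (update-view h x (b + suc k) y))
      (≤-trans 1≤b (m≤m+n b k))
      (subst (b + k <_) (sym h₁x) b+k<top)
      (λ y y∈ same e → [ (λ { (refl , e') → <-irrefl (sym (trans (sym e') e)) b+k<top }) ,
                         (λ { (y≢x , e') → proj₁ (avoids (outside y y∈ y≢x same)) (trans (sym e') e) }) ]′
                       (update-view h x (b + suc k) y))
      (λ r'' p q → ⊥-elim (<-irrefl (sym (+-suc b k)) (≤-<-trans p (subst (r'' <_) h₁x q)))))
      (λ y y∈ same e → [ proj₁ ,
                         (λ { (y≢x , e') → ⊥-elim (proj₂ (avoids (outside y y∈ y≢x same))
                                                        (trans (sym e') (trans e h₁x))) }) ]′
                       (update-view h x (b + suc k) y))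

  slide-down : ∀ h x top b → x ∈ D0 → h x ≡ top → 1 ≤ b → b ≤ top →
    (∀ j → b < j → j ≤ top → ∀ y → y ∈ D0 → y ≢ x → h y ≡ j → proj₂ y ≤ proj₂ x) →
    (∀ y → y ∈ D0 → y ≢ x → proj₂ y ≡ proj₂ x → h y < b ⊎ top < h y) →
    Steps (place h) (place (h [ x ≔ b ]))
  slide-down h x top b x∈ hx≡top 1≤b b≤top rightmost outside =
    subst (λ D → Steps D (place (h [ x ≔ b ])))
      (place-cong (λ z _ → update-id h x _ (trans hx≡top (sym b+[top∸b])) z))
      (slide-down-by h x x∈ b (top ∸ b) 1≤b (λ j p q → rightmost j p (subst (j ≤_) b+[top∸b] q))
        (λ y y∈ y≢x same → [ inj₁ , (λ l → inj₂ (subst (_< h y) (sym b+[top∸b]) l)) ]′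
                             (outside y y∈ y≢x same)))
    where b+[top∸b] = m+[n∸m]≡n b≤top

  occupant : ∀ {h r c} → (r , c) ∈ place h → ∃[ y ] (y ∈ D0 × proj₂ y ≡ c × h y ≡ r)
  occupant {h} r,c∈ with ∈-place⁻ {h} r,c∈
  ... | y , y∈ , e = y , y∈ , sym (cong proj₂ e) , sym (cong proj₁ e)

  rightmost-at-height : ∀ (h : Heights) y → y ∈ D0 →
    ∃[ x ] (x ∈ D0 × h x ≡ h y × proj₂ y ≤ proj₂ x × (∀ z → z ∈ D0 → h z ≡ h x → proj₂ z ≤ proj₂ x))
  rightmost-at-height h y y∈ with maximum-satisfying proj₂ {λ z → h z ≡ h y} (λ z → h z ≟ h y) D0
  ... | inj₂ none = ⊥-elim (none y y∈ refl)
  ... | inj₁ (x , x∈ , hx≡hy , max) = x , x∈ , hx≡hy , max y y∈ refl , λ z z∈ e → max z z∈ (trans e hx≡hy)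

  Stuck : Heights → Set
  Stuck h = ∀ x → x ∈ D0 → (∀ y → y ∈ D0 → h y ≡ h x → proj₂ y ≤ proj₂ x) →
            ∀ r'' → 1 ≤ r'' → r'' < h x → (r'' , proj₂ x) ∈ place h

  Minimal : Diagram → Set
  Minimal D = ∀ E → Reach D E → E ≈ D

  stuck⇒minimal : ∀ h → Stuck h → Minimal (place h)
  stuck⇒minimal h stuck E (F , ε , F≈E) = ≈-sym F≈E
  stuck⇒minimal h stuck E (F , (r , c , r' , r,c∈ , rightmost , 1≤r' , r'<r , r',c∉ , _) ◅ _ , _)
    with occupant {h} r,c∈
  ... | x , x∈ , refl , refl =
    ⊥-elim (r',c∉ (stuck x x∈ (λ y y∈ e → rightmost (proj₂ y) (∈-place⁺ y y∈ (cong (_, proj₂ y) (sym e))))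
                         r' 1≤r' r'<r))

  -- A move vacates the old position of x, so the diagram below D would differ from D.
  minimal⇒no-descent : ∀ {D h x r'} → D ≈ place h → Minimal D → x ∈ D0 → Unshared h x → ¬ Descent h x r'
  minimal⇒no-descent {D} {h} {x} {r'} D≈ minimal x∈ unshared d =
    vacated (to (place-update h x r' unshared x∈ (h x , proj₂ x))
                (from (moved≈D _) (from (D≈ _) (∈-place⁺ x x∈ refl))))
    where
    moved≈D : place (h [ x ≔ r' ]) ≈ D
    moved≈D = minimal _ (_ , KohnertStep-respˡ-≈ (≈-sym D≈) (kohnertStep-update h x r' x∈ d unshared) ◅ ε ,
                         ≈-refl)
    vacated : ((h x , proj₂ x) ∈ place h × (h x , proj₂ x) ≢ (h x , proj₂ x)) ⊎ (h x , proj₂ x) ≡ (r' , proj₂ x) →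
              ⊥
    vacated (inj₁ (_ , ≢self)) = ≢self refl
    vacated (inj₂ e) = <-irrefl (sym (cong proj₁ e)) (Descent.r'<hx d)

  minimal⇒stuck : ∀ {D} h → (∀ x → x ∈ D0 → Unshared h x) → D ≈ place h → Minimal D → Stuck h
  minimal⇒stuck {D} h unshared D≈ minimal x x∈ rightmost r0 1≤r0 r0<hx with (r0 , proj₂ x) ∈? place h
  ... | yes r0∈ = r0∈
  ... | no r0∉ with highest-gap (place h) (proj₂ x) r0 (h x) r0<hx r0∉
  ... | r' , r0≤r' , r'<hx , r'∉ , filled =
    ⊥-elim (minimal⇒no-descent D≈ minimal x∈ (unshared x x∈)
              (descent rightmost (≤-trans 1≤r0 r0≤r') r'<hx
                       (λ y y∈ same e → r'∉ (∈-place⁺ y y∈ (cong₂ _,_ (sym e) (sym same))))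
                       filled))

module TwoRowDiagram (D0 : Diagram) (r1 r2 : ℕ) (two-row : TwoRow D0 r1 r2) where
  open Placement D0 public

  r1<r2 : r1 < r2
  r1<r2 = proj₁ (proj₂ two-row)

  r1≢r2 : r1 ≢ r2
  r1≢r2 = <⇒≢ r1<r2

  row-of : ∀ {a c} → (a , c) ∈ D0 → a ≡ r1 ⊎ a ≡ r2
  row-of {a} {c} = proj₂ (proj₂ (proj₂ (proj₂ two-row))) a c

  1≤row : ∀ {a c} → (a , c) ∈ D0 → 1 ≤ a
  1≤row {a} {c} a,c∈ = proj₁ (proj₁ two-row a c a,c∈)

  1≤column : ∀ {a c} → (a , c) ∈ D0 → 1 ≤ c
  1≤column {a} {c} a,c∈ = proj₂ (proj₁ two-row a c a,c∈)

  Both : ℕ → Set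
  Both c = (r1 , c) ∈ D0 × (r2 , c) ∈ D0

  Both? : Decidable Both
  Both? c = ((r1 , c) ∈? D0) ×-dec ((r2 , c) ∈? D0)

  BothRightOf : ℕ → Set
  BothRightOf c = Any (λ y → c < proj₂ y × Both (proj₂ y)) D0

  BothRightOf? : Decidable BothRightOf
  BothRightOf? c = any? (λ y → (c <? proj₂ y) ×-dec Both? (proj₂ y)) D0

  bothRightOf⁺ : ∀ {c m} → Both m → c < m → BothRightOf c
  bothRightOf⁺ both c<m = Any.map (λ { refl → c<m , both }) (proj₁ both)

  bothRightOf⁻ : ∀ {c} → BothRightOf c → ∃[ m ] (Both m × c < m)
  bothRightOf⁻ right with satisfied right
  ... | y , c<m , both = proj₂ y , both , c<m

  bothRightOf-mono : ∀ {c c'} → c ≤ c' → BothRightOf c' → BothRightOf c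
  bothRightOf-mono c≤c' right with bothRightOf⁻ right
  ... | m , both , c'<m = bothRightOf⁺ both (≤-<-trans c≤c' c'<m)

  colLeft⇒bothRightOf : ∀ {c} → ColLeft D0 r1 r2 c → BothRightOf c
  colLeft⇒bothRightOf (_ , _ , m , m₁ , m₂ , c<m) = bothRightOf⁺ (m₁ , m₂) c<m

  colLeft⁺ : ∀ {c} → (r1 , c) ∈ D0 → (r2 , c) ∉ D0 → BothRightOf c → ColLeft D0 r1 r2 c
  colLeft⁺ r1,c∈ r2,c∉ right with bothRightOf⁻ right
  ... | m , (m₁ , m₂) , c<m = r1,c∈ , r2,c∉ , m , m₁ , m₂ , c<m

  -- The minimal diagram M_t: lower cells of columns ≤ t go to row 2, other lower cells to
  -- row 1; in a column with two cells the upper one takes the remaining row, and a lone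
  -- upper cell goes to row 2 exactly when a two-cell column lies to its right.
  target : ℕ → Heights
  target t (a , c) with a ≟ r1 | c ≤? t | Both? c | BothRightOf? c
  ... | yes _ | yes _ | _ | _ = 2
  ... | yes _ | no _ | _ | _ = 1
  ... | no _ | yes _ | yes _ | _ = 1
  ... | no _ | no _ | yes _ | _ = 2
  ... | no _ | _ | no _ | yes _ = 2
  ... | no _ | _ | no _ | no _ = 1

  target≡1⊎2 : ∀ t y → target t y ≡ 1 ⊎ target t y ≡ 2
  target≡1⊎2 t (a , c) with a ≟ r1 | c ≤? t | Both? c | BothRightOf? c
  ... | yes _ | yes _ | _ | _ = inj₂ refl
  ... | yes _ | no _ | _ | _ = inj₁ refl
  ... | no _ | yes _ | yes _ | _ = inj₁ refl
  ... | no _ | no _ | yes _ | _ = inj₂ refl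
  ... | no _ | yes _ | no _ | yes _ = inj₂ refl
  ... | no _ | no _ | no _ | yes _ = inj₂ refl
  ... | no _ | yes _ | no _ | no _ = inj₁ refl
  ... | no _ | no _ | no _ | no _ = inj₁ refl

  target≤2 : ∀ t y → target t y ≤ 2
  target≤2 t y = [ (λ e → subst (_≤ 2) (sym e) (s≤s z≤n)) , (λ e → subst (_≤ 2) (sym e) ≤-refl) ]′
                   (target≡1⊎2 t y)

  1≤target : ∀ t y → 1 ≤ target t y
  1≤target t y = [ (λ e → subst (1 ≤_) (sym e) ≤-refl) , (λ e → subst (1 ≤_) (sym e) (s≤s z≤n)) ]′
                   (target≡1⊎2 t y)

  target-lower : ∀ t c → (c ≤ t × target t (r1 , c) ≡ 2) ⊎ (t < c × target t (r1 , c) ≡ 1)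
  target-lower t c with r1 ≟ r1 | c ≤? t | Both? c | BothRightOf? c
  ... | no r1≢r1 | _ | _ | _ = ⊥-elim (r1≢r1 refl)
  ... | yes _ | yes c≤t | _ | _ = inj₁ (c≤t , refl)
  ... | yes _ | no c≰t | _ | _ = inj₂ (≰⇒> c≰t , refl)

  target-lower-≤ : ∀ {t c} → c ≤ t → target t (r1 , c) ≡ 2
  target-lower-≤ {t} {c} c≤t = [ proj₂ , (λ { (t<c , _) → ⊥-elim (<⇒≱ t<c c≤t) }) ]′ (target-lower t c)

  target-lower-> : ∀ {t c} → t < c → target t (r1 , c) ≡ 1
  target-lower-> {t} {c} t<c = [ (λ { (c≤t , _) → ⊥-elim (<⇒≱ t<c c≤t) }) , proj₂ ]′ (target-lower t c)

  data UpperTarget (t c : ℕ) : ℕ → Set where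
    both-≤     : Both c → c ≤ t → UpperTarget t c 1
    both->     : Both c → t < c → UpperTarget t c 2
    lone-right : ¬ Both c → BothRightOf c → UpperTarget t c 2
    lone-last  : ¬ Both c → ¬ BothRightOf c → UpperTarget t c 1

  target-upper : ∀ t c → UpperTarget t c (target t (r2 , c))
  target-upper t c with r2 ≟ r1 | c ≤? t | Both? c | BothRightOf? c
  ... | yes r2≡r1 | _ | _ | _ = ⊥-elim (r1≢r2 (sym r2≡r1))
  ... | no _ | yes c≤t | yes both | _ = both-≤ both c≤t
  ... | no _ | no c≰t | yes both | _ = both-> both (≰⇒> c≰t)
  ... | no _ | yes _ | no ¬both | yes right = lone-right ¬both right
  ... | no _ | no _ | no ¬both | yes right = lone-right ¬both right
  ... | no _ | yes _ | no ¬both | no ¬right = lone-last ¬both ¬right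
  ... | no _ | no _ | no ¬both | no ¬right = lone-last ¬both ¬right

  -- Reaching the minimal diagrams M_t

  width : ℕ
  width = proj₁ (strict-upper-bound proj₂ D0)

  column<width : ∀ y → y ∈ D0 → proj₂ y < width
  column<width = proj₂ (strict-upper-bound proj₂ D0)

  -- M_t is reached column by column from right to left, first for the lower row (with the
  -- upper row untouched), then for the upper row.
  module Reaching (t : ℕ) (room : 1 ≤ t → 2 ≤ r1)
                  (left-of-both : ∀ c → 1 ≤ c → c ≤ t → BothRightOf c) where

    LowerMoved : ℕ → Cell → Set
    LowerMoved p (a , c) = a ≡ r1 × p ≤ c

    LowerMoved? : ∀ p → Decidable (LowerMoved p)
    LowerMoved? p (a , c) = (a ≟ r1) ×-dec (p ≤? c)

    lowerPhase : ℕ → Heights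
    lowerPhase p y = if does (LowerMoved? p y) then target t y else proj₁ y

    lowerPhase-lower : ∀ p c → (p ≤ c × lowerPhase p (r1 , c) ≡ target t (r1 , c))
                             ⊎ (c < p × lowerPhase p (r1 , c) ≡ r1)
    lowerPhase-lower p c with p ≤? c
    ... | yes p≤c = inj₁ (p≤c , if-yes (LowerMoved? p (r1 , c)) (refl , p≤c))
    ... | no p≰c = inj₂ (≰⇒> p≰c , if-no (LowerMoved? p (r1 , c)) (p≰c ∘ proj₂))

    lowerPhase-upper : ∀ p c → lowerPhase p (r2 , c) ≡ r2
    lowerPhase-upper p c = if-no (LowerMoved? p (r2 , c)) (r1≢r2 ∘ sym ∘ proj₁)

    lowerPhase-suc : ∀ p y → y ≢ (r1 , p) → lowerPhase (suc p) y ≡ lowerPhase p y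
    lowerPhase-suc p (a , c) y≢ =
      cong (λ b → if b then target t (a , c) else a)
           (does-⇔ (mk⇔ (λ (a≡ , p<c) → a≡ , <⇒≤ p<c)
                        (λ { (refl , p≤c) → refl , ≤∧≢⇒< p≤c (λ { refl → y≢ refl }) }))
                   (LowerMoved? (suc p) (a , c)) (LowerMoved? p (a , c)))

    lowerPhase-step : ∀ p → 1 ≤ p → Steps (place (lowerPhase (suc p))) (place (lowerPhase p))
    lowerPhase-step p 1≤p with (r1 , p) ∈? D0
    ... | no r1,p∉ = subst (Steps _) (place-cong λ y y∈ → lowerPhase-suc p y λ { refl → r1,p∉ y∈ }) ε
    ... | yes x∈ =
      subst (Steps _) (place-cong moved)
        (slide-down h x r1 d x∈ hx≡r1 (1≤target t x) d≤r1 rightmost outside)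
      where
      x = (r1 , p)
      h = lowerPhase (suc p)
      d = target t x
      hx≡r1 : h x ≡ r1
      hx≡r1 = if-no (LowerMoved? (suc p) x) (λ (_ , p<p) → <-irrefl refl p<p)
      moved : ∀ y → y ∈ D0 → (h [ x ≔ d ]) y ≡ lowerPhase p y
      moved y _ with update-view h x d y
      ... | inj₁ (refl , e) = trans e (sym (if-yes (LowerMoved? p x) (refl , ≤-refl)))
      ... | inj₂ (y≢x , e) = trans e (lowerPhase-suc p y y≢x)
      d≤r1 : d ≤ r1
      d≤r1 = [ (λ (p≤t , e) → subst (_≤ r1) (sym e) (room (≤-trans 1≤p p≤t))) ,
               (λ (_ , e) → subst (_≤ r1) (sym e) (1≤row x∈)) ]′ (target-lower t p)
      -- a cell right of p above row d = 1 is a lower cell already in row 2, so its column is ≤ t < p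
      rightmost : ∀ j → d < j → j ≤ r1 → ∀ y → y ∈ D0 → y ≢ x → h y ≡ j → proj₂ y ≤ p
      rightmost j d<j j≤r1 (a , c) y∈ y≢x hy≡j with row-of y∈
      ... | inj₂ refl =
        ⊥-elim (<⇒≱ r1<r2 (subst (_≤ r1) (trans (sym hy≡j) (lowerPhase-upper (suc p) c)) j≤r1))
      ... | inj₁ refl with lowerPhase-lower (suc p) c
      ...   | inj₂ (c<sp , _) = ≤-pred c<sp
      ...   | inj₁ (p<c , hy≡ty) with target-lower t c | target-lower t p
      ...     | inj₂ (_ , ty≡1) | _ =
        ⊥-elim (<⇒≱ (subst (d <_) (trans (sym hy≡j) (trans hy≡ty ty≡1)) d<j) (1≤target t x))
      ...     | inj₁ (_ , ty≡2) | inj₁ (_ , d≡2) =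
        ⊥-elim (<-irrefl (trans d≡2 (sym (trans (sym hy≡j) (trans hy≡ty ty≡2)))) d<j)
      ...     | inj₁ (c≤t , _) | inj₂ (t<p , _) = ⊥-elim (<-asym p<c (≤-<-trans c≤t t<p))
      outside : ∀ y → y ∈ D0 → y ≢ x → proj₂ y ≡ p → h y < d ⊎ r1 < h y
      outside (a , c) y∈ y≢x refl with row-of y∈
      ... | inj₁ refl = ⊥-elim (y≢x refl)
      ... | inj₂ refl = inj₂ (subst (r1 <_) (sym (lowerPhase-upper (suc p) c)) r1<r2)

    lowerPhase-steps : ∀ n p → 1 ≤ p → Steps (place (lowerPhase (n + p))) (place (lowerPhase p))
    lowerPhase-steps zero p _ = ε
    lowerPhase-steps (suc n) p 1≤p =
      subst (λ q → Steps (place (lowerPhase q)) (place (lowerPhase (suc p)))) (+-suc n p)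
        (lowerPhase-steps n (suc p) (≤-trans 1≤p (n≤1+n p)))
      ◅◅ lowerPhase-step p 1≤p

    UpperPending : ℕ → Cell → Set
    UpperPending q (a , c) = a ≡ r2 × c < q

    UpperPending? : ∀ q → Decidable (UpperPending q)
    UpperPending? q (a , c) = (a ≟ r2) ×-dec (c <? q)

    upperPhase : ℕ → Heights
    upperPhase q y = if does (UpperPending? q y) then proj₁ y else target t y

    upperPhase-lower : ∀ q c → upperPhase q (r1 , c) ≡ target t (r1 , c)
    upperPhase-lower q c = if-no (UpperPending? q (r1 , c)) (r1≢r2 ∘ proj₁)

    upperPhase-upper : ∀ q c → (q ≤ c × upperPhase q (r2 , c) ≡ target t (r2 , c))
                             ⊎ (c < q × upperPhase q (r2 , c) ≡ r2)
    upperPhase-upper q c with c <? q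
    ... | yes c<q = inj₂ (c<q , if-yes (UpperPending? q (r2 , c)) (refl , c<q))
    ... | no c≮q = inj₁ (≮⇒≥ c≮q , if-no (UpperPending? q (r2 , c)) (c≮q ∘ proj₂))

    upperPhase-suc : ∀ q y → y ≢ (r2 , q) → upperPhase (suc q) y ≡ upperPhase q y
    upperPhase-suc q (a , c) y≢ =
      cong (λ b → if b then a else target t (a , c))
           (does-⇔ (mk⇔ (λ { (refl , c<1+q) → refl , ≤∧≢⇒< (≤-pred c<1+q) (λ { refl → y≢ refl }) })
                        (λ (a≡ , c<q) → a≡ , m<n⇒m<1+n c<q))
                   (UpperPending? (suc q) (a , c)) (UpperPending? q (a , c)))

    module UpperStep (q : ℕ) (1≤q : 1 ≤ q) (x∈ : (r2 , q) ∈ D0) where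

      x : Cell
      x = (r2 , q)

      h : Heights
      h = upperPhase (suc q)

      hx≡r2 : h x ≡ r2
      hx≡r2 = if-yes (UpperPending? (suc q) x) (refl , ≤-refl)

      settle : ∀ v → target t x ≡ v → place (h [ x ≔ v ]) ≡ place (upperPhase q)
      settle v target≡v = place-cong λ y _ → [ (λ { (refl , e) → trans e (sym pending) }) ,
                                                (λ (y≢x , e) → trans e (upperPhase-suc q y y≢x)) ]′
                                              (update-view h x v y)
        where
        pending : upperPhase q x ≡ v
        pending = trans (if-no (UpperPending? q x) (λ (_ , q<q) → <-irrefl refl q<q)) target≡v

      lower-neighbour : ∀ y → y ∈ D0 → y ≢ x → proj₂ y ≡ q → y ≡ (r1 , q)
      lower-neighbour (a , c) y∈ y≢x refl with row-of y∈
      ... | inj₁ refl = refl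
      ... | inj₂ refl = ⊥-elim (y≢x refl)

      2≤r2 : ∀ {c} → (r1 , c) ∈ D0 → 2 ≤ r2
      2≤r2 r1,c∈ = ≤-trans (s≤s (1≤row r1,c∈)) r1<r2

      high-rightmost : ∀ j → 3 ≤ j → ∀ y → y ∈ D0 → y ≢ x → h y ≡ j → proj₂ y ≤ q
      high-rightmost j 3≤j (a , c) y∈ _ hy≡j with row-of y∈
      ... | inj₁ refl = ⊥-elim (<⇒≱ 3≤j (subst (_≤ 2) (trans (sym (upperPhase-lower (suc q) c)) hy≡j)
                                                      (target≤2 t _)))
      ... | inj₂ refl =
        [ (λ (_ , e) → ⊥-elim (<⇒≱ 3≤j (subst (_≤ 2) (trans (sym e) hy≡j) (target≤2 t _)))) ,
          (λ (c<1+q , _) → ≤-pred c<1+q) ]′ (upperPhase-upper (suc q) c)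

      right-of-height-2 : ∀ y → y ∈ D0 → h y ≡ 2 → q < proj₂ y → BothRightOf q
      right-of-height-2 (a , c) y∈ hy≡2 q<c with row-of y∈
      ... | inj₁ refl =
        [ (λ (c≤t , _) → bothRightOf-mono (<⇒≤ q<c) (left-of-both c (1≤column y∈) c≤t)) ,
          (λ (_ , e) → ⊥-elim (1≢2 (trans (sym e) (trans (sym (upperPhase-lower (suc q) c)) hy≡2)))) ]′
        (target-lower t c)
      ... | inj₂ refl =
        [ (λ (_ , e) → upper (trans (sym e) hy≡2) (target-upper t c)) ,
          (λ (c<1+q , _) → ⊥-elim (<⇒≱ q<c (≤-pred c<1+q))) ]′ (upperPhase-upper (suc q) c)
        where
        upper : ∀ {v} → v ≡ 2 → UpperTarget t c v → BothRightOf q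
        upper () (both-≤ _ _)
        upper _ (both-> both _) = bothRightOf⁺ both q<c
        upper _ (lone-right _ right) = bothRightOf-mono (<⇒≤ q<c) right
        upper () (lone-last _ _)

      step-both-> : Both q → t < q → target t x ≡ 2 → Steps (place h) (place (upperPhase q))
      step-both-> both t<q target≡2 =
        subst (Steps _) (settle 2 target≡2)
          (slide-down h x r2 2 x∈ hx≡r2 (s≤s z≤n) (2≤r2 (proj₁ both))
                      (λ j 2<j _ → high-rightmost j 2<j) below)
        where
        below : ∀ y → y ∈ D0 → y ≢ x → proj₂ y ≡ q → h y < 2 ⊎ r2 < h y
        below y y∈ y≢x same rewrite lower-neighbour y y∈ y≢x same =
          inj₁ (subst (_< 2) (sym (trans (upperPhase-lower (suc q) q) (target-lower-> t<q))) ≤-refl)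

      step-lone-right : ¬ Both q → BothRightOf q → target t x ≡ 2 → Steps (place h) (place (upperPhase q))
      step-lone-right ¬both right target≡2 =
        subst (Steps _) (settle 2 target≡2)
          (slide-down h x r2 2 x∈ hx≡r2 (s≤s z≤n) (2≤r2 (proj₁ (proj₁ (proj₂ (bothRightOf⁻ right)))))
            (λ j 2<j _ → high-rightmost j 2<j) alone)
        where
        alone : ∀ y → y ∈ D0 → y ≢ x → proj₂ y ≡ q → h y < 2 ⊎ r2 < h y
        alone y y∈ y≢x same = ⊥-elim (¬both (subst (_∈ D0) (lower-neighbour y y∈ y≢x same) y∈ , x∈))

      step-lone-last : ¬ Both q → ¬ BothRightOf q → target t x ≡ 1 → Steps (place h) (place (upperPhase q))
      step-lone-last ¬both ¬right target≡1 =
        subst (Steps _) (settle 1 target≡1)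
          (slide-down h x r2 1 x∈ hx≡r2 ≤-refl (1≤row x∈) rightmost alone)
        where
        rightmost : ∀ j → 1 < j → j ≤ r2 → ∀ y → y ∈ D0 → y ≢ x → h y ≡ j → proj₂ y ≤ q
        rightmost j 1<j _ y y∈ y≢x hy≡j with m≤n⇒m<n∨m≡n 1<j
        ... | inj₁ 2<j = high-rightmost j 2<j y y∈ y≢x hy≡j
        ... | inj₂ refl = ≮⇒≥ (¬right ∘ right-of-height-2 y y∈ hy≡j)
        alone : ∀ y → y ∈ D0 → y ≢ x → proj₂ y ≡ q → h y < 1 ⊎ r2 < h y
        alone y y∈ y≢x same = ⊥-elim (¬both (subst (_∈ D0) (lower-neighbour y y∈ y≢x same) y∈ , x∈))

      -- The upper cell must end in row 1 below the lower cell, which already sits in row 2: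
      -- it slides down to row 3 and then jumps over row 2 in one Kohnert move.
      step-both-≤ : Both q → q ≤ t → target t x ≡ 1 → Steps (place h) (place (upperPhase q))
      step-both-≤ both q≤t target≡1 =
        subst (Steps _) landed
          (slide-down h x r2 3 x∈ hx≡r2 (s≤s z≤n) 3≤r2 (λ j 3<j _ → high-rightmost j (<⇒≤ 3<j)) below-3
           ◅◅ jump ◅ ε)
        where
        3≤r2 : 3 ≤ r2
        3≤r2 = ≤-trans (s≤s (room (≤-trans 1≤q q≤t))) r1<r2
        lower≡2 : h (r1 , q) ≡ 2
        lower≡2 = trans (upperPhase-lower (suc q) q) (target-lower-≤ q≤t)
        below-3 : ∀ y → y ∈ D0 → y ≢ x → proj₂ y ≡ q → h y < 3 ⊎ r2 < h y
        below-3 y y∈ y≢x same rewrite lower-neighbour y y∈ y≢x same =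
          inj₁ (subst (_< 3) (sym lower≡2) ≤-refl)
        h₃ = h [ x ≔ 3 ]
        h₃x : h₃ x ≡ 3
        h₃x = update-updates h x 3
        h₃-lower : ∀ y → y ∈ D0 → proj₂ y ≡ q → y ≢ x → h₃ y ≡ 2
        h₃-lower y y∈ same y≢x rewrite lower-neighbour y y∈ y≢x same =
          trans (update-minimal h x 3 (r1 , q) (r1≢r2 ∘ cong proj₁)) lower≡2
        jump : KohnertStep (place h₃) (place (h₃ [ x ≔ 1 ]))
        jump = kohnertStep-update h₃ x 1 x∈ (descent
          (λ y y∈ e → [ (λ { (refl , _) → ≤-refl }) ,
                        (λ (y≢x , e') → high-rightmost 3 ≤-refl y y∈ y≢x (trans (sym e') (trans e h₃x))) ]′
                      (update-view h x 3 y))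
          ≤-refl
          (subst (1 <_) (sym h₃x) (s≤s (s≤s z≤n)))
          (λ y y∈ same e → case-x y (λ { refl → 3≢1 (trans (sym h₃x) e) })
                                  (λ y≢x → 2≢1 (trans (sym (h₃-lower y y∈ same y≢x)) e)))
          (λ r'' 1<r'' r''<3 → ∈-place⁺ (r1 , q) (proj₁ both)
             (cong (_, q) (sym (trans (h₃-lower (r1 , q) (proj₁ both) refl (r1≢r2 ∘ cong proj₁))
                                      (≤-antisym 1<r'' (≤-pred (subst (r'' <_) h₃x r''<3))))))))
          (λ y y∈ same e → case-x y id
                             (λ y≢x → ⊥-elim (2≢3 (trans (sym (h₃-lower y y∈ same y≢x)) (trans e h₃x)))))
          where
          case-x : ∀ {A : Set} y → (y ≡ x → A) → (y ≢ x → A) → A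
          case-x y yes-x no-x = [ yes-x , no-x ]′ (toSum (y ≟ᶜ x))
          3≢1 : 3 ≢ 1
          3≢1 ()
          2≢1 : 2 ≢ 1
          2≢1 ()
          2≢3 : 2 ≢ 3
          2≢3 ()
        landed : place (h₃ [ x ≔ 1 ]) ≡ place (upperPhase q)
        landed = trans (place-cong (λ z _ → update-update h x 3 1 z)) (settle 1 target≡1)

    upperPhase-step : ∀ q → 1 ≤ q → Steps (place (upperPhase (suc q))) (place (upperPhase q))
    upperPhase-step q 1≤q with (r2 , q) ∈? D0
    ... | no r2,q∉ = subst (Steps _) (place-cong λ y y∈ → upperPhase-suc q y λ { refl → r2,q∉ y∈ }) ε
    ... | yes x∈ = by-target refl (target-upper t q)
      where
      open UpperStep q 1≤q x∈
      by-target : ∀ {v} → target t x ≡ v → UpperTarget t q v → Steps (place h) (place (upperPhase q))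
      by-target e (both-≤ both q≤t) = step-both-≤ both q≤t e
      by-target e (both-> both t<q) = step-both-> both t<q e
      by-target e (lone-right ¬both right) = step-lone-right ¬both right e
      by-target e (lone-last ¬both ¬right) = step-lone-last ¬both ¬right e

    upperPhase-steps : ∀ n q → 1 ≤ q → Steps (place (upperPhase (n + q))) (place (upperPhase q))
    upperPhase-steps zero q _ = ε
    upperPhase-steps (suc n) q 1≤q =
      subst (λ p → Steps (place (upperPhase p)) (place (upperPhase (suc q)))) (+-suc n q)
        (upperPhase-steps n (suc q) (≤-trans 1≤q (n≤1+n q)))
      ◅◅ upperPhase-step q 1≤q

    ≮width+1 : ∀ y → y ∈ D0 → ¬ (width + 1 ≤ proj₂ y)
    ≮width+1 y y∈ le = <⇒≱ (<-≤-trans (column<width y y∈) (m≤m+n width 1)) le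

    lowerPhase-start : place (lowerPhase (width + 1)) ≡ D0
    lowerPhase-start = trans (place-cong λ y y∈ → if-no (LowerMoved? (width + 1) y) (≮width+1 y y∈ ∘ proj₂))
                             place-rows

    lowerPhase-end : place (lowerPhase 1) ≡ place (upperPhase (width + 1))
    lowerPhase-end = place-cong λ where
      (a , c) y∈ → [ (λ { refl → trans (if-yes (LowerMoved? 1 (r1 , c)) (refl , 1≤column y∈))
                                        (sym (upperPhase-lower (width + 1) c)) }) ,
                     (λ { refl → trans (lowerPhase-upper 1 c)
                                       (sym (if-yes (UpperPending? (width + 1) (r2 , c))
                                                    (refl , ≰⇒> (≮width+1 (r2 , c) y∈)))) }) ]′
                   (row-of y∈)

    upperPhase-end : place (upperPhase 1) ≡ place (target t)
    upperPhase-end = place-cong λ y y∈ → if-no (UpperPending? 1 y) (λ (_ , c<1) → <⇒≱ c<1 (1≤column y∈))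

    reach-target : Steps D0 (place (target t))
    reach-target =
      subst₂ Steps lowerPhase-start lowerPhase-end (lowerPhase-steps width 1 ≤-refl)
      ◅◅ subst (Steps _) upperPhase-end (upperPhase-steps width 1 ≤-refl)

  -- Reachable placements

  record Invariant (h : Heights) : Set where
    field
      column-injective : ∀ y y' → y ∈ D0 → y' ∈ D0 → proj₂ y ≡ proj₂ y' → h y ≡ h y' → y ≡ y'
      within-row : ∀ y → y ∈ D0 → 1 ≤ h y × h y ≤ proj₁ y
      lone-upper-dominates : ∀ c m → (r2 , c) ∈ D0 → (r1 , c) ∉ D0 → Both m → c < m →
                             h (r1 , m) ≤ h (r2 , c) × h (r2 , m) ≤ h (r2 , c)
      lone-lower-antitone : ∀ c c' → (r1 , c) ∈ D0 → (r2 , c) ∉ D0 → (r1 , c') ∈ D0 → (r2 , c') ∉ D0 →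
                            c < c' → h (r1 , c') ≤ h (r1 , c)

    unshared : ∀ x → x ∈ D0 → Unshared h x
    unshared x x∈ y y∈ = column-injective y x y∈ x∈
  open Invariant

  invariant-rows : Invariant proj₁
  invariant-rows = record
    { column-injective = λ { (a , c) (a' , c') _ _ refl refl → refl }
    ; within-row = λ y y∈ → 1≤row y∈ , ≤-refl
    ; lone-upper-dominates = λ _ _ _ _ _ _ → <⇒≤ r1<r2 , ≤-refl
    ; lone-lower-antitone = λ _ _ _ _ _ _ _ → ≤-refl
    }

  module _ {h x r'} (I : Invariant h) (x∈ : x ∈ D0) (d : Descent h x r') where
    open Descent d

    Lone : Set
    Lone = ∀ y → y ∈ D0 → proj₂ y ≡ proj₂ x → y ≡ x

    lowered : ∀ z → (h [ x ≔ r' ]) z ≤ h z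
    lowered z with update-view h x r' z
    ... | inj₁ (refl , e) = subst (_≤ h x) (sym e) (<⇒≤ r'<hx)
    ... | inj₂ (_ , e) = ≤-reflexive e

    lone-descends-one : Lone → h x ≡ suc r'
    lone-descends-one lone with h x ≤? suc r'
    ... | yes hx≤1+r' = ≤-antisym hx≤1+r' r'<hx
    ... | no hx≰1+r' with ∈-place⁻ {h} (occupied (suc r') ≤-refl (≰⇒> hx≰1+r'))
    ...   | y , y∈ , e with lone y y∈ (sym (cong proj₂ e))
    ...     | refl = sym (cong proj₁ e)

    -- A lone cell moves down exactly one row, and cells to its right are not in its row.
    right-of-lone : Lone → ∀ y → y ∈ D0 → proj₂ x < proj₂ y → h y ≤ h x → h y ≤ r'
    right-of-lone lone y y∈ x<y hy≤hx =
      ≤-pred (subst (h y <_) (lone-descends-one lone)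
                    (≤∧≢⇒< hy≤hx (λ e → <⇒≱ x<y (rightmost y y∈ e))))

    invariant-descent : Invariant (h [ x ≔ r' ])
    column-injective invariant-descent y y' y∈ y'∈ same e
      with update-view h x r' y | update-view h x r' y'
    ... | inj₁ (refl , _) | inj₁ (refl , _) = refl
    ... | inj₁ (refl , v) | inj₂ (_ , v') =
      ⊥-elim (vacant y' y'∈ (sym same) (trans (sym v') (trans (sym e) v)))
    ... | inj₂ (_ , v) | inj₁ (refl , v') = ⊥-elim (vacant y y∈ same (trans (sym v) (trans e v')))
    ... | inj₂ (_ , v) | inj₂ (_ , v') = column-injective I y y' y∈ y'∈ same (trans (sym v) (trans e v'))
    within-row invariant-descent y y∈ with update-view h x r' y
    ... | inj₁ (refl , v) = subst (1 ≤_) (sym v) 1≤r' ,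
                            subst (_≤ proj₁ y) (sym v) (≤-trans (<⇒≤ r'<hx) (proj₂ (within-row I y y∈)))
    ... | inj₂ (_ , v) = subst (λ w → 1 ≤ w × w ≤ proj₁ y) (sym v) (within-row I y y∈)
    lone-upper-dominates invariant-descent c m c∈ r1,c∉ both c<m
      with update-view h x r' (r2 , c) | lone-upper-dominates I c m c∈ r1,c∉ both c<m
    ... | inj₂ (_ , v) | lower≤ , upper≤ =
      ≤-trans (lowered _) (subst (h (r1 , m) ≤_) (sym v) lower≤) ,
      ≤-trans (lowered _) (subst (h (r2 , m) ≤_) (sym v) upper≤)
    ... | inj₁ (refl , v) | lower≤ , upper≤ =
      subst ((h [ x ≔ r' ]) (r1 , m) ≤_) (sym v)
            (≤-trans (lowered (r1 , m)) (right-of-lone lone (r1 , m) (proj₁ both) c<m lower≤)) ,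
      subst ((h [ x ≔ r' ]) (r2 , m) ≤_) (sym v)
            (≤-trans (lowered (r2 , m)) (right-of-lone lone (r2 , m) (proj₂ both) c<m upper≤))
      where
      lone : Lone
      lone (a , _) z∈ refl with row-of z∈
      ... | inj₁ refl = ⊥-elim (r1,c∉ z∈)
      ... | inj₂ refl = refl
    lone-lower-antitone invariant-descent c c' c∈ r2,c∉ c'∈ r2,c'∉ c<c'
      with update-view h x r' (r1 , c) | lone-lower-antitone I c c' c∈ r2,c∉ c'∈ r2,c'∉ c<c'
    ... | inj₂ (_ , v) | antitone =
      ≤-trans (lowered _) (subst (h (r1 , c') ≤_) (sym v) antitone)
    ... | inj₁ (refl , v) | antitone =
      subst ((h [ x ≔ r' ]) (r1 , c') ≤_) (sym v)
            (≤-trans (lowered (r1 , c')) (right-of-lone lone (r1 , c') c'∈ c<c' antitone))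
      where
      lone : Lone
      lone (a , _) z∈ refl with row-of z∈
      ... | inj₁ refl = refl
      ... | inj₂ refl = ⊥-elim (r2,c∉ z∈)

  invariant-steps : ∀ {D F} h → Invariant h → D ≈ place h → Steps D F →
                    ∃[ h' ] (Invariant h' × F ≈ place h')
  invariant-steps h I D≈ ε = h , I , D≈
  invariant-steps h I D≈ (step ◅ steps) with kohnertStep⇒descent h (unshared I) D≈ step
  ... | x , r' , x∈ , d , F≈ = invariant-steps (h [ x ≔ r' ]) (invariant-descent I x∈ d) F≈ steps

  reachable⇒invariant : ∀ {F} → Steps D0 F → ∃[ h ] (Invariant h × F ≈ place h)
  reachable⇒invariant = invariant-steps proj₁ invariant-rows (subst (D0 ≈_) (sym place-rows) ≈-refl)

  -- Stuck placements

  column-cells : ∀ y₁ y₂ y₃ → y₁ ∈ D0 → y₂ ∈ D0 → y₃ ∈ D0 → proj₂ y₁ ≡ proj₂ y₂ → proj₂ y₁ ≡ proj₂ y₃ →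
                 y₁ ≡ y₂ ⊎ y₁ ≡ y₃ ⊎ y₂ ≡ y₃
  column-cells _ _ _ y₁∈ y₂∈ y₃∈ refl refl with row-of y₁∈ | row-of y₂∈ | row-of y₃∈
  ... | inj₁ refl | inj₁ refl | _ = inj₁ refl
  ... | inj₂ refl | inj₂ refl | _ = inj₁ refl
  ... | inj₁ refl | inj₂ refl | inj₁ refl = inj₂ (inj₁ refl)
  ... | inj₁ refl | inj₂ refl | inj₂ refl = inj₂ (inj₂ refl)
  ... | inj₂ refl | inj₁ refl | inj₁ refl = inj₂ (inj₂ refl)
  ... | inj₂ refl | inj₁ refl | inj₂ refl = inj₂ (inj₁ refl)

  column-both : ∀ y y' → y ∈ D0 → y' ∈ D0 → proj₂ y ≡ proj₂ y' → y ≢ y' → Both (proj₂ y)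
  column-both _ _ y∈ y'∈ refl y≢y' with row-of y∈ | row-of y'∈
  ... | inj₁ refl | inj₁ refl = ⊥-elim (y≢y' refl)
  ... | inj₁ refl | inj₂ refl = y∈ , y'∈
  ... | inj₂ refl | inj₁ refl = y'∈ , y∈
  ... | inj₂ refl | inj₂ refl = ⊥-elim (y≢y' refl)

  Stacked : Heights → ℕ → Set
  Stacked f c = (f (r1 , c) ≡ 1 × f (r2 , c) ≡ 2) ⊎ (f (r1 , c) ≡ 2 × f (r2 , c) ≡ 1)

  stacked-occupies : ∀ {f c} → Both c → Stacked f c → ∀ v → v ≡ 1 ⊎ v ≡ 2 →
                     ∃[ y ] (y ∈ D0 × proj₂ y ≡ c × f y ≡ v)
  stacked-occupies (r1,c∈ , _) (inj₁ (e , _)) _ (inj₁ refl) = _ , r1,c∈ , refl , e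
  stacked-occupies (_ , r2,c∈) (inj₁ (_ , e)) _ (inj₂ refl) = _ , r2,c∈ , refl , e
  stacked-occupies (_ , r2,c∈) (inj₂ (_ , e)) _ (inj₁ refl) = _ , r2,c∈ , refl , e
  stacked-occupies (r1,c∈ , _) (inj₂ (e , _)) _ (inj₂ refl) = _ , r1,c∈ , refl , e

  place-⊆ : ∀ f f' → (∀ y → y ∈ D0 → f y ≡ 1 ⊎ f y ≡ 2) → (∀ c → Both c → Stacked f' c) →
            (∀ y → y ∈ D0 → ¬ Both (proj₂ y) → f y ≡ f' y) → ∀ z → z ∈ place f → z ∈ place f'
  place-⊆ f f' f≡1⊎2 stacked agree z z∈ with ∈-place⁻ {f} z∈
  ... | y , y∈ , refl with Both? (proj₂ y)
  ...   | no ¬both = ∈-place⁺ y y∈ (cong (_, proj₂ y) (agree y y∈ ¬both))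
  ...   | yes both with stacked-occupies both (stacked _ both) (f y) (f≡1⊎2 y y∈)
  ...     | y' , y'∈ , same , e = ∈-place⁺ y' y'∈ (cong₂ _,_ (sym e) (sym same))

  target-stacked : ∀ t c → Both c → Stacked (target t) c
  target-stacked t c both = stack refl (target-upper t c)
    where
    stack : ∀ {v} → target t (r2 , c) ≡ v → UpperTarget t c v → Stacked (target t) c
    stack e (both-≤ _ c≤t) = inj₂ (target-lower-≤ c≤t , e)
    stack e (both-> _ t<c) = inj₁ (target-lower-> t<c , e)
    stack _ (lone-right ¬both _) = ⊥-elim (¬both both)
    stack _ (lone-last ¬both _) = ⊥-elim (¬both both)

  ColLeft? : Decidable (ColLeft D0 r1 r2)
  ColLeft? c = map′ (λ (r1,c∈ , r2,c∉ , right) → colLeft⁺ r1,c∈ r2,c∉ right)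
                    (λ col-left → proj₁ col-left , proj₁ (proj₂ col-left) , colLeft⇒bothRightOf col-left)
                    (((r1 , c) ∈? D0) ×-dec (¬? ((r2 , c) ∈? D0) ×-dec BothRightOf? c))

  colLeft-list : List ℕ
  colLeft-list = filter ColLeft? (upTo width)

  ∈-colLeft-list : ∀ c → c ∈ colLeft-list ⇔ ColLeft D0 r1 r2 c
  ∈-colLeft-list c = mk⇔ (λ c∈ → proj₂ (∈-filter⁻ ColLeft? {xs = upTo width} c∈))
                         (λ col-left → ∈-filter⁺ ColLeft? (∈-upTo⁺ (column<width _ (proj₁ col-left))) col-left)

  colLeft-list-increasing : AllPairs _<_ colLeft-list
  colLeft-list-increasing = AllPairsₚ.filter⁺ ColLeft? (AllPairsₚ.applyUpTo⁺₁ id width (λ i<j _ → i<j))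

  module StuckShape {h} (I : Invariant h) (stuck : Stuck h) where

    no-height-3 : ∀ x → x ∈ D0 → (∀ y → y ∈ D0 → h y ≡ h x → proj₂ y ≤ proj₂ x) → ¬ (2 < h x)
    no-height-3 x x∈ rightmost 2<hx
      with occupant (stuck x x∈ rightmost 1 ≤-refl (<⇒≤ 2<hx))
         | occupant (stuck x x∈ rightmost 2 (s≤s z≤n) 2<hx)
    ... | y₁ , y₁∈ , same₁ , hy₁≡1 | y₂ , y₂∈ , same₂ , hy₂≡2
      with column-cells x y₁ y₂ x∈ y₁∈ y₂∈ (sym same₁) (sym same₂)
    ... | inj₁ refl = <⇒≱ 2<hx (subst (_≤ 2) (sym hy₁≡1) (s≤s z≤n))
    ... | inj₂ (inj₁ refl) = <-irrefl (sym hy₂≡2) 2<hx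
    ... | inj₂ (inj₂ refl) = 1≢2 (trans (sym hy₁≡1) hy₂≡2)

    height≤2 : ∀ y → y ∈ D0 → h y ≤ 2
    height≤2 y y∈ with rightmost-at-height h y y∈
    ... | x , x∈ , hx≡hy , _ , rightmost = ≮⇒≥ (no-height-3 x x∈ rightmost ∘ subst (2 <_) (sym hx≡hy))

    height≡1⊎2 : ∀ y → y ∈ D0 → h y ≡ 1 ⊎ h y ≡ 2
    height≡1⊎2 y y∈ = 1≤n≤2⇒n≡1⊎n≡2 (proj₁ (within-row I y y∈)) (height≤2 y y∈)

    both-stacked : ∀ c → Both c → Stacked h c
    both-stacked c both@(r1,c∈ , r2,c∈) with height≡1⊎2 _ r1,c∈ | height≡1⊎2 _ r2,c∈
    ... | inj₁ lower≡1 | inj₂ upper≡2 = inj₁ (lower≡1 , upper≡2)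
    ... | inj₂ lower≡2 | inj₁ upper≡1 = inj₂ (lower≡2 , upper≡1)
    ... | inj₁ lower≡1 | inj₁ upper≡1 =
      ⊥-elim (r1≢r2 (cong proj₁ (column-injective I _ _ r1,c∈ r2,c∈ refl (trans lower≡1 (sym upper≡1)))))
    ... | inj₂ lower≡2 | inj₂ upper≡2 =
      ⊥-elim (r1≢r2 (cong proj₁ (column-injective I _ _ r1,c∈ r2,c∈ refl (trans lower≡2 (sym upper≡2)))))

    lone-upper-right : ∀ c → (r2 , c) ∈ D0 → (r1 , c) ∉ D0 → BothRightOf c → h (r2 , c) ≡ 2
    lone-upper-right c r2,c∈ r1,c∉ right with bothRightOf⁻ right
    ... | m , both , c<m with lone-upper-dominates I c m r2,c∈ r1,c∉ both c<m | both-stacked m both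
    ...   | _ , upper≤ | inj₁ (_ , upper≡2) =
      ≤-antisym (height≤2 _ r2,c∈) (subst (_≤ h (r2 , c)) upper≡2 upper≤)
    ...   | lower≤ , _ | inj₂ (lower≡2 , _) =
      ≤-antisym (height≤2 _ r2,c∈) (subst (_≤ h (r2 , c)) lower≡2 lower≤)

    lone-last-low : ∀ y → y ∈ D0 → ¬ Both (proj₂ y) → ¬ BothRightOf (proj₂ y) → h y ≡ 1
    lone-last-low y y∈ ¬both ¬right with height≡1⊎2 y y∈
    ... | inj₁ hy≡1 = hy≡1
    ... | inj₂ hy≡2 with rightmost-at-height h y y∈
    ...   | x , x∈ , hx≡hy , y≤x , rightmost
      with occupant (stuck x x∈ rightmost 1 ≤-refl (subst (1 <_) (sym (trans hx≡hy hy≡2)) ≤-refl))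
    ...   | y₁ , y₁∈ , same , hy₁≡1 with column-both x y₁ x∈ y₁∈ (sym same)
                                              (λ { refl → 1≢2 (trans (sym hy₁≡1) (trans hx≡hy hy≡2)) })
    ...     | both = ⊥-elim ([ (λ y<x → ¬right (bothRightOf⁺ both y<x)) ,
                               (λ { refl → ¬both both }) ]′ (m≤n⇒m<n∨m≡n y≤x))

    module _ (t : ℕ) (row-2-up-to-t : ∀ c → ColLeft D0 r1 r2 c → (h (r1 , c) ≡ 2 ⇔ c ≤ t))
             (left-of-both : ∀ c → 1 ≤ c → c ≤ t → BothRightOf c) where

      col-left-agrees-target : ∀ c → ColLeft D0 r1 r2 c → h (r1 , c) ≡ target t (r1 , c)
      col-left-agrees-target c col-left =
        [ (λ (c≤t , e) → trans (from (row-2-up-to-t c col-left) c≤t) (sym e)) ,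
          (λ (t<c , e) → [ (λ h≡1 → trans h≡1 (sym e)) ,
                           (λ h≡2 → ⊥-elim (<⇒≱ t<c (to (row-2-up-to-t c col-left) h≡2))) ]′
                         (height≡1⊎2 _ (proj₁ col-left))) ]′
        (target-lower t c)

      lone-agrees-target : ∀ y → y ∈ D0 → ¬ Both (proj₂ y) → h y ≡ target t y
      lone-agrees-target (a , c) y∈ ¬both with row-of y∈
      ... | inj₁ refl with toSum (BothRightOf? c)
      ...   | inj₁ right = col-left-agrees-target c (colLeft⁺ y∈ (λ r2,c∈ → ¬both (y∈ , r2,c∈)) right)
      lone-agrees-target (a , c) y∈ ¬both | inj₁ refl | inj₂ ¬right =
        [ (λ (c≤t , _) → ⊥-elim (¬right (left-of-both c (1≤column y∈) c≤t))) ,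
          (λ (_ , e) → trans (lone-last-low _ y∈ ¬both ¬right) (sym e)) ]′ (target-lower t c)
      lone-agrees-target (a , c) y∈ ¬both | inj₂ refl = upper refl (target-upper t c)
        where
        upper : ∀ {v} → target t (r2 , c) ≡ v → UpperTarget t c v → h (r2 , c) ≡ target t (r2 , c)
        upper _ (both-≤ both _) = ⊥-elim (¬both both)
        upper _ (both-> both _) = ⊥-elim (¬both both)
        upper e (lone-right _ right) =
          trans (lone-upper-right c y∈ (λ r1,c∈ → ¬both (r1,c∈ , y∈)) right) (sym e)
        upper e (lone-last _ ¬right) = trans (lone-last-low _ y∈ ¬both ¬right) (sym e)

      stuck≈target : place h ≈ place (target t)
      stuck≈target z =
        mk⇔ (place-⊆ h (target t) height≡1⊎2 (target-stacked t) lone-agrees-target z)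
            (place-⊆ (target t) h (λ y _ → target≡1⊎2 t y) both-stacked
                     (λ y y∈ ¬both → sym (lone-agrees-target y y∈ ¬both)) z)

    stuck⇒target : place h ≈ place (target 0)
                 ⊎ ∃[ t ] (ColLeft D0 r1 r2 t × 2 ≤ r1 × place h ≈ place (target t))
    stuck⇒target with maximum-satisfying id {λ c → h (r1 , c) ≡ 2} (λ c → h (r1 , c) ≟ 2) colLeft-list
    ... | inj₂ none = inj₁ (stuck≈target 0 row-2-none (λ c 1≤c c≤0 → ⊥-elim (<⇒≱ 1≤c c≤0)))
      where
      row-2-none : ∀ c → ColLeft D0 r1 r2 c → (h (r1 , c) ≡ 2 ⇔ c ≤ 0)
      row-2-none c col-left = mk⇔ (λ h≡2 → ⊥-elim (none c (from (∈-colLeft-list c) col-left) h≡2))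
                                  (λ c≤0 → ⊥-elim (<⇒≱ (1≤column (proj₁ col-left)) c≤0))
    ... | inj₁ (t , t∈ , ht≡2 , max) = inj₂ (t , col-left-t , 2≤r1 , stuck≈target t row-2 left-of-both)
      where
      col-left-t : ColLeft D0 r1 r2 t
      col-left-t = to (∈-colLeft-list t) t∈
      2≤r1 : 2 ≤ r1
      2≤r1 = subst (_≤ r1) ht≡2 (proj₂ (within-row I _ (proj₁ col-left-t)))
      -- lone lower cells left of t are weakly higher than the one at t, hence also in row 2
      row-2 : ∀ c → ColLeft D0 r1 r2 c → (h (r1 , c) ≡ 2 ⇔ c ≤ t)
      row-2 c col-left@(r1,c∈ , r2,c∉ , _) =
        mk⇔ (max c (from (∈-colLeft-list c) col-left))
            (λ c≤t → [ (λ c<t → ≤-antisym (height≤2 _ r1,c∈)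
                                   (subst (_≤ h (r1 , c)) ht≡2
                                          (lone-lower-antitone I c t r1,c∈ r2,c∉ (proj₁ col-left-t)
                                                               (proj₁ (proj₂ col-left-t)) c<t))) ,
                       (λ { refl → ht≡2 }) ]′ (m≤n⇒m<n∨m≡n c≤t))
      left-of-both : ∀ c → 1 ≤ c → c ≤ t → BothRightOf c
      left-of-both c _ c≤t = bothRightOf-mono c≤t (colLeft⇒bothRightOf col-left-t)

  minimal⇒target : ∀ {D} → IsMin D0 D →
    D ≈ place (target 0) ⊎ ∃[ t ] (ColLeft D0 r1 r2 t × 2 ≤ r1 × D ≈ place (target t))
  minimal⇒target {D} ((F , steps , F≈D) , minimal) with reachable⇒invariant steps
  ... | h , I , F≈h = Sum.map (≈-trans D≈h) (Product.map₂ (Product.map₂ (Product.map₂ (≈-trans D≈h))))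
                              (StuckShape.stuck⇒target I (minimal⇒stuck h (unshared I) D≈h minimal))
    where
    D≈h : D ≈ place h
    D≈h = ≈-trans (≈-sym F≈D) F≈h

  high⇒both-or-right : ∀ t → (∀ c → 1 ≤ c → c ≤ t → BothRightOf c) →
    ∀ y → y ∈ D0 → target t y ≡ 2 → ¬ Both (proj₂ y) → BothRightOf (proj₂ y)
  high⇒both-or-right t left-of-both (a , c) y∈ ty≡2 ¬both with row-of y∈
  ... | inj₁ refl = [ (λ (c≤t , _) → left-of-both c (1≤column y∈) c≤t) ,
                      (λ (_ , ty≡1) → ⊥-elim (1≢2 (trans (sym ty≡1) ty≡2))) ]′ (target-lower t c)
  ... | inj₂ refl = upper refl (target-upper t c)
    where
    upper : ∀ {v} → target t (r2 , c) ≡ v → UpperTarget t c v → BothRightOf c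
    upper _ (both-≤ both _) = ⊥-elim (¬both both)
    upper _ (both-> both _) = ⊥-elim (¬both both)
    upper _ (lone-right _ right) = right
    upper ty≡1 (lone-last _ _) = ⊥-elim (1≢2 (trans (sym ty≡1) ty≡2))

  target-stuck : ∀ t → (∀ c → 1 ≤ c → c ≤ t → BothRightOf c) → Stuck (target t)
  target-stuck t left-of-both x x∈ rightmost r'' 1≤r'' r''<tx with target≡1⊎2 t x
  ... | inj₁ tx≡1 = ⊥-elim (<⇒≱ (subst (r'' <_) tx≡1 r''<tx) 1≤r'')
  ... | inj₂ tx≡2 with ≤-antisym (≤-pred (subst (r'' <_) tx≡2 r''<tx)) 1≤r'' | toSum (Both? (proj₂ x))
  ...   | refl | inj₁ both with stacked-occupies {target t} both (target-stacked t _ both) 1 (inj₁ refl)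
  ...     | y , y∈ , same , ty≡1 = ∈-place⁺ y y∈ (cong₂ _,_ (sym ty≡1) (sym same))
  target-stuck t left-of-both x x∈ rightmost r'' 1≤r'' r''<tx | inj₂ tx≡2 | refl | inj₂ ¬both
    with bothRightOf⁻ (high⇒both-or-right t left-of-both x x∈ tx≡2 ¬both)
  ...   | m , both , x<m with stacked-occupies {target t} both (target-stacked t m both) 2 (inj₂ refl)
  ...     | y , y∈ , refl , ty≡2 = ⊥-elim (<⇒≱ x<m (rightmost y y∈ (trans ty≡2 (sym tx≡2))))

  target-minimal : ∀ t → (1 ≤ t → 2 ≤ r1) → (∀ c → 1 ≤ c → c ≤ t → BothRightOf c) →
                   IsMin D0 (place (target t))
  target-minimal t room left-of-both =
    (place (target t) , Reaching.reach-target t room left-of-both , ≈-refl) ,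
    stuck⇒minimal (target t) (target-stuck t left-of-both)

  target-distinct : ∀ {t t'} → t < t' → ColLeft D0 r1 r2 t' → ¬ (place (target t) ≈ place (target t'))
  target-distinct {t} {t'} t<t' (r1,t'∈ , r2,t'∉ , _) same
    with occupant {target t} (from (same _) (∈-place⁺ (r1 , t') r1,t'∈
                                                      (cong (_, t') (sym (target-lower-≤ ≤-refl)))))
  ... | (a , _) , y∈ , refl , ty≡2 with row-of y∈
  ...   | inj₁ refl = 1≢2 (trans (sym (target-lower-> t<t')) ty≡2)
  ...   | inj₂ refl = r2,t'∉ y∈

  -- Counting the minimal diagrams

  targets : List Diagram
  targets = map (place ∘ target) (0 ∷ colLeft-list)

  target-0-minimal : IsMin D0 (place (target 0))
  target-0-minimal = target-minimal 0 (λ ()) (λ c 1≤c c≤0 → ⊥-elim (<⇒≱ 1≤c c≤0))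

  targets-minimal : 1 < r1 → All (IsMin D0) targets
  targets-minimal 1<r1 = Allₚ.map⁺ (target-0-minimal ∷ All.tabulate λ {t} t∈ →
    target-minimal t (λ _ → 1<r1)
      (λ c _ c≤t → bothRightOf-mono c≤t (colLeft⇒bothRightOf (to (∈-colLeft-list t) t∈))))

  targets-distinct : AllPairs (λ D E → ¬ (D ≈ E)) targets
  targets-distinct =
    AllPairsₚ.map⁺ (AllPairs.map (λ (t<t' , col-left) → target-distinct t<t' col-left) increasing)
    where
    increasing : AllPairs (λ t t' → t < t' × ColLeft D0 r1 r2 t') (0 ∷ colLeft-list)
    increasing = All.tabulate (λ {c} c∈ → 1≤column (proj₁ (to (∈-colLeft-list c) c∈)) , to (∈-colLeft-list c) c∈)
               ∷ allPairs-zipʳ colLeft-list-increasing (All.tabulate (to (∈-colLeft-list _)))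

  targets-complete : ∀ D → IsMin D0 D → Any (_≈ D) targets
  targets-complete D minimal = Anyₚ.map⁺ ([ (λ D≈ → here (≈-sym D≈)) ,
                                          (λ (t , col-left , _ , D≈) → there (Any.map (λ { refl → ≈-sym D≈ })
                                                                        (from (∈-colLeft-list t) col-left))) ]′
                                        (minimal⇒target minimal))

  colLeft-card : HasCard (ColLeft D0 r1 r2) (length colLeft-list)
  colLeft-card = colLeft-list , refl , AllPairs.map <⇒≢ colLeft-list-increasing , ∈-colLeft-list

  minimal-card : 1 < r1 → MinCard D0 (suc (length colLeft-list))
  minimal-card 1<r1 = targets , length-map _ (0 ∷ colLeft-list) , targets-distinct , targets-minimal 1<r1 ,
                      targets-complete

  minimal-card-r1≡1 : r1 ≡ 1 → MinCard D0 1
  minimal-card-r1≡1 r1≡1 = place (target 0) ∷ [] , refl , [] ∷ [] , target-0-minimal ∷ [] ,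
    λ D minimal → [ (λ D≈ → here (≈-sym D≈)) ,
                    (λ (_ , _ , 2≤r1 , _) → ⊥-elim (<⇒≱ (subst (1 <_) r1≡1 2≤r1) ≤-refl)) ]′
                  (minimal⇒target minimal)

theorem5p3 : (D0 : Diagram) (r1 r2 : ℕ) → TwoRow D0 r1 r2 →
    (1 < r1 → ∃[ k ] (HasCard (ColLeft D0 r1 r2) k × MinCard D0 (suc k)))
    × (r1 ≡ 1 → MinCard D0 1)
theorem5p3 D0 r1 r2 two-row =
  (λ 1<r1 → length colLeft-list , colLeft-card , minimal-card 1<r1) , minimal-card-r1≡1
  where open TwoRowDiagram D0 r1 r2 two-row
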